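{- Suppose a strong AMD code with sources $s_1,\dots,s_m$ over an additive abelian group $\mathcal{G}$ of order $n$ has equiprobable encoding and is R-optimal. Then the sets $A(s_1),\dots,A(s_m)$ form an $(n,m;k_1,\dots,k_m;\lambda_1,\dots,\lambda_m)$-generalized strong external difference family, where $k_i=|A(s_i)|$ and $\lambda_i=\frac{k_i(a-k_i)}{n-1}$ with $a=\sum_i k_i$.
   Context: For disjoint subsets $A,B$ of $\mathcal{G}$, $\mathcal{D}(A,B)$ denotes the multiset $\{x-y : x\in A, y\in B\}$. An $(n,m;k_1,\dots,k_m;\lambda_1,\dots,\lambda_m)$-GSEDF is a collection of $m$ pairwise disjoint subsets $A_1,\dots,A_m$ of $\mathcal{G}$ with $|A_i|=k_i$ such that for every $i$, $\bigcup_{j\ne i}\mathcal{D}(A_i,A_j)=\lambda_i(\mathcal{G}\setminus\{0\})$ as multisets. An AMD code over $\mathcal{G}$ ($n\ge2$) with source set $\mathcal{S}$ consists of pairwise disjoint nonempty subsets $A(s)\subseteq\mathcal{G}$ and a public encoding function $E$ mapping $s$ to some $g\in A(s)$; equiprobable encoding means $E(s)$ is uniform on $A(s)$. Strong security game for a source $s$: $s$ is given to the adversary, who chooses $\Delta\in\mathcal{G}\setminus\{0\}$ by a (possibly randomized) strategy; then $g=E(s)$; the adversary wins iff $g+\Delta\in A(s')$ for some $s'\ne s$. $\hat\epsilon_s$ is the maximum winning probability over all strategies for source $s$. With $a_s=|A(s)|$ and $a=\sum_s a_s$, the code is R-optimal if $\hat\epsilon_s=(a-a_s)/(n-1)$ for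 every source $s$.
   Formalization: The adversary's randomized strategies in $\hat\epsilon_s$ take values in the rationals rather than the reals, and the encoding probabilities are likewise given as rationals. -}

module Defs where

open import Data.Nat as ℕ using (ℕ; zero; suc; _∸_)
open import Data.Fin using (Fin; zero; suc)
open import Data.Fin.Properties using (_≟_)
open import Data.Fin.Subset using (Subset; _∈_; _∉_; ∣_∣; Nonempty)
open import Data.Vec using (lookup)
open import Data.Bool using (Bool; true; false; if_then_else_; _∧_; _∨_; not)
open import Data.Integer using (+_)
open import Data.Rational as ℚ using (ℚ; 0ℚ; 1ℚ; _/_; _≤_)
open import Data.Product using (Σ; ∃; _×_; _,_)
open import Algebra.Structures using (IsAbelianGroup)
open import Relation.Binary.PropositionalEquality using (_≡_; _≢_)
open import Relation.Nullary.Decidable using (⌊_⌋)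

-- An additive abelian group of order n, with carrier Fin n
-- (every finite abelian group of order n is isomorphic to one of these).
record FinAbGroup (n : ℕ) : Set where
  field
    _+_ : Fin n → Fin n → Fin n
    0# : Fin n
    -_ : Fin n → Fin n
    isAbelianGroup : IsAbelianGroup _≡_ _+_ 0# -_
  _-_ : Fin n → Fin n → Fin n
  x - y = x + (- y)

Σℕ : ∀ {k} → (Fin k → ℕ) → ℕ
Σℕ {zero}  f = 0
Σℕ {suc k} f = f zero ℕ.+ Σℕ (λ i → f (suc i))

Σℚ : ∀ {k} → (Fin k → ℚ) → ℚ
Σℚ {zero}  f = 0ℚ
Σℚ {suc k} f = f zero ℚ.+ Σℚ (λ i → f (suc i))

anyᵇ : ∀ {k} → (Fin k → Bool) → Bool
anyᵇ {zero}  f = false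
anyᵇ {suc k} f = f zero ∨ anyᵇ (λ i → f (suc i))

[_] : Bool → ℕ
[ b ] = if b then 1 else 0

_∈ᵇ_ : ∀ {n} → Fin n → Subset n → Bool
x ∈ᵇ A = lookup A x

_≟ᵇ_ : ∀ {n} → Fin n → Fin n → Bool
x ≟ᵇ y = ⌊ x ≟ y ⌋

-- h / d as a rational (d is always ≥ 1 where used)
frac : ℕ → ℕ → ℚ
frac h zero    = 0ℚ
frac h (suc d) = (+ h) / (suc d)

module _ {n m : ℕ} (A : Fin m → Subset n) where

  PairwiseDisjoint : Set
  PairwiseDisjoint = ∀ i j → i ≢ j → ∀ x → x ∈ A i → x ∉ A j

  total : ℕ
  total = Σℕ (λ i → ∣ A i ∣)

  inOthers : Fin m → Fin n → Bool
  inOthers i x = anyᵇ (λ j → not (j ≟ᵇ i) ∧ (x ∈ᵇ A j))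

record AMDCode {n} (G : FinAbGroup n) (m : ℕ) : Set where
  field
    A        : Fin m → Subset n
    nonempty : ∀ s → Nonempty (A s)
    disjoint : PairwiseDisjoint A
    -- randomized encoding: enc s g = Pr[E(s) = g]
    enc      : Fin m → Fin n → ℚ

module _ {n} {G : FinAbGroup n} {m : ℕ} (C : AMDCode G m) where
  open FinAbGroup G
  open AMDCode C

  Equiprobable : Set
  Equiprobable = ∀ s g → enc s g ≡ (if g ∈ᵇ A s then frac 1 ∣ A s ∣ else 0ℚ)

  record Strategy : Set where
    field
      p      : Fin n → ℚ
      p0     : p 0# ≡ 0ℚ
      p≥0    : ∀ Δ → 0ℚ ≤ p Δ
      p-sum  : Σℚ p ≡ 1ℚ

  winProb : Fin m → Strategy → ℚ
  winProb s σ = Σℚ (λ Δ → Strategy.p σ Δ ℚ.*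
                  Σℚ (λ g → enc s g ℚ.* frac [ inOthers A s (g + Δ) ] 1))

  IsMaxWinProb : Fin m → ℚ → Set
  IsMaxWinProb s r = (∃ λ σ → winProb s σ ≡ r) × (∀ σ → winProb s σ ≤ r)

  ROptimal : Set
  ROptimal = ∀ s → IsMaxWinProb s (frac (total A ∸ ∣ A s ∣) (n ∸ 1))

module _ {n} (G : FinAbGroup n) where
  open FinAbGroup G

  extDiffCount : ∀ {m} → (Fin m → Subset n) → Fin m → Fin n → ℕ
  extDiffCount A i d =
    Σℕ (λ j → [ not (j ≟ᵇ i) ] ℕ.*
      Σℕ (λ x → Σℕ (λ y →
        [ (x ∈ᵇ A i) ∧ (y ∈ᵇ A j) ∧ ((x - y) ≟ᵇ d) ])))

  IsGSEDF : (m : ℕ) → (k : Fin m → ℕ) → (λs : Fin m → ℕ) → (Fin m → Subset n) → Set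
  IsGSEDF m k λs A =
    PairwiseDisjoint A
    × (∀ i → ∣ A i ∣ ≡ k i)
    × (∀ i d → extDiffCount A i d ≡ (if d ≟ᵇ 0# then 0 else λs i))

module Submission where

-- For a source s and d ≠ 0, the adversary who always plays Δ = -d wins exactly when
-- E(s) - d lies in some other A(s'), so under equiprobable encoding it wins with
-- probability N_s(d) / k_s, where N_s(d) is the multiplicity of d in ⋃_{j≠s} D(A_s, A_j).
-- R-optimality bounds this by (a - k_s)/(n - 1), i.e. N_s(d)(n - 1) ≤ k_s(a - k_s).
-- But Σ_d N_s(d) = k_s(a - k_s) and N_s(0) = 0 by disjointness, so each of these n - 1
-- bounds is an equality and N_s is constant on G \ {0}.

open import Defs
open import Data.Nat using (ℕ; _≤_; _*_; _∸_)
open import Data.Fin using (Fin)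
open import Data.Fin.Subset using (∣_∣)
open import Data.Product using (∃; _×_)
open import Relation.Binary.PropositionalEquality using (_≡_)

open import Algebra.Bundles using (AbelianGroup)
import Algebra.Properties.AbelianGroup as AbelianGroupProperties
open import Data.Bool using (Bool; true; false; if_then_else_; _∧_; not)
open import Data.Bool.Properties using (∧-zeroʳ; ∧-identityʳ; ∧-conicalʳ)
open import Data.Empty using (⊥; ⊥-elim)
open import Data.Fin using (zero; suc; punchIn)
open import Data.Fin.Properties using (_≟_; suc-injective; punchInᵢ≢i)
open import Data.Fin.Subset using (Subset; _∈_; _∉_; Nonempty)
open import Data.Fin.Subset.Properties using (p⊆q⇒∣p∣≤∣q∣; ∣⁅x⁆∣≡1; x∈⁅y⁆⇒x≡y)
import Data.Integer as ℤ
import Data.Integer.Properties as ℤ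
open import Data.Nat using (zero; suc; _+_; _<_; z≤n; s≤s)
open import Data.Nat.Properties
  using ( +-identityʳ; +-mono-≤; +-mono-<-≤; +-mono-≤-<; m+n∸m≡n; ∸-monoˡ-≤
        ; *-comm; *-zeroʳ; *-identityˡ; *-distribˡ-+; *-distribʳ-+; *-distribʳ-∸
        ; *-cancelʳ-≡; +-commutativeSemigroup; *-commutativeSemigroup
        ; ≤-reflexive; ≤-antisym; ≮⇒≥; <⇒≱ )
open import Algebra.Properties.CommutativeSemigroup +-commutativeSemigroup
  using () renaming (interchange to +-interchange)
open import Algebra.Properties.CommutativeSemigroup *-commutativeSemigroup
  using () renaming (x∙yz≈y∙xz to *-leftComm)
open import Data.Product using (_,_; proj₂)
open import Data.Rational as ℚ using (ℚ; 0ℚ; 1ℚ; toℚᵘ)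
open import Data.Rational.Properties as ℚ
  using (toℚᵘ-fromℚᵘ; toℚᵘ-injective; toℚᵘ-homo-+; toℚᵘ-mono-≤)
open import Data.Rational.Unnormalised using (mkℚᵘ; _≃_; *≡*; *≤*)
open import Data.Rational.Unnormalised.Properties using (≃-trans; ≃-sym; +-cong; ≤-respˡ-≃; ≤-respʳ-≃)
open import Data.Vec using ([]; _∷_)
open import Data.Vec.Properties using (lookup⇒[]=)
open import Relation.Binary.PropositionalEquality using (_≢_; refl; sym; trans; cong; cong₂; subst; subst₂; module ≡-Reasoning)
open import Function using (_∘_)
open import Relation.Nullary using (Dec; yes; no)
open import Relation.Nullary.Decidable using (dec-true; dec-false; isYes≗does; isYes)

[∧]≡[]*[] : ∀ a b → [ a ∧ b ] ≡ [ a ] * [ b ]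
[∧]≡[]*[] true  true  = refl
[∧]≡[]*[] true  false = refl
[∧]≡[]*[] false _     = refl

[]*[]≡0 : ∀ {a b} → (a ≡ true → b ≡ true → ⊥) → [ a ] * [ b ] ≡ 0
[]*[]≡0 {true}  {true}  both = ⊥-elim (both refl refl)
[]*[]≡0 {true}  {false} _    = refl
[]*[]≡0 {false}         _    = refl

≟ᵇ-≡ : ∀ {n} {x y : Fin n} → x ≡ y → x ≟ᵇ y ≡ true
≟ᵇ-≡ {x = x} {y} x≡y = trans (isYes≗does (x ≟ y)) (dec-true (x ≟ y) x≡y)

≟ᵇ-≢ : ∀ {n} {x y : Fin n} → x ≢ y → x ≟ᵇ y ≡ false
≟ᵇ-≢ {x = x} {y} x≢y = trans (isYes≗does (x ≟ y)) (dec-false (x ≟ y) x≢y)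

[∧∧≟ᵇ]≡[]*[] : ∀ a b {k} {x y : Fin k} → x ≡ y → [ a ∧ b ∧ (x ≟ᵇ y) ] ≡ [ a ] * [ b ]
[∧∧≟ᵇ]≡[]*[] a b x≡y rewrite ≟ᵇ-≡ x≡y | ∧-identityʳ b = [∧]≡[]*[] a b

[∧∧≟ᵇ]≡0 : ∀ a b {k} {x y : Fin k} → x ≢ y → [ a ∧ b ∧ (x ≟ᵇ y) ] ≡ 0
[∧∧≟ᵇ]≡0 a b x≢y rewrite ≟ᵇ-≢ x≢y | ∧-zeroʳ b | ∧-zeroʳ a = refl

[]*+[not]*≡ : ∀ b v → [ b ] * v + [ not b ] * v ≡ v
[]*+[not]*≡ true  v = trans (+-identityʳ _) (+-identityʳ v)
[]*+[not]*≡ false v = +-identityʳ v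

Σℕ-cong : ∀ {k} {f g : Fin k → ℕ} → (∀ i → f i ≡ g i) → Σℕ f ≡ Σℕ g
Σℕ-cong {zero}  f≗g = refl
Σℕ-cong {suc k} f≗g = cong₂ _+_ (f≗g zero) (Σℕ-cong (λ i → f≗g (suc i)))

Σℕ-zero : ∀ {k} (f : Fin k → ℕ) → (∀ i → f i ≡ 0) → Σℕ f ≡ 0
Σℕ-zero {zero}  f f≗0 = refl
Σℕ-zero {suc k} f f≗0 = cong₂ _+_ (f≗0 zero) (Σℕ-zero (λ i → f (suc i)) (λ i → f≗0 (suc i)))

Σℕ-const : ∀ {k} v → Σℕ {k} (λ _ → v) ≡ k * v
Σℕ-const {zero}  v = refl
Σℕ-const {suc k} v = cong (v +_) (Σℕ-const {k} v)

Σℕ-+ : ∀ {k} (f g : Fin k → ℕ) → Σℕ (λ i → f i + g i) ≡ Σℕ f + Σℕ g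
Σℕ-+ {zero}  f g = refl
Σℕ-+ {suc k} f g =
  trans (cong (f zero + g zero +_) (Σℕ-+ (λ i → f (suc i)) (λ i → g (suc i)))) (+-interchange (f zero) (g zero) _ _)

Σℕ-*ˡ : ∀ {k} c (f : Fin k → ℕ) → Σℕ (λ i → c * f i) ≡ c * Σℕ f
Σℕ-*ˡ {zero}  c f = sym (*-zeroʳ c)
Σℕ-*ˡ {suc k} c f =
  trans (cong (c * f zero +_) (Σℕ-*ˡ c (λ i → f (suc i)))) (sym (*-distribˡ-+ c (f zero) _))

Σℕ-*ʳ : ∀ {k} c (f : Fin k → ℕ) → Σℕ (λ i → f i * c) ≡ Σℕ f * c
Σℕ-*ʳ {zero}  c f = refl
Σℕ-*ʳ {suc k} c f =
  trans (cong (f zero * c +_) (Σℕ-*ʳ c (λ i → f (suc i)))) (sym (*-distribʳ-+ c (f zero) _))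

Σℕ-swap : ∀ {k l} (f : Fin k → Fin l → ℕ) →
          Σℕ (λ i → Σℕ (λ j → f i j)) ≡ Σℕ (λ j → Σℕ (λ i → f i j))
Σℕ-swap {zero} {l} f = sym (Σℕ-zero {l} _ (λ _ → refl))
Σℕ-swap {suc k} f =
  trans (cong (Σℕ (f zero) +_) (Σℕ-swap (λ i → f (suc i)))) (sym (Σℕ-+ (f zero) _))

Σℕ-single : ∀ {k} (f : Fin k → ℕ) c → (∀ i → i ≢ c → f i ≡ 0) → Σℕ f ≡ f c
Σℕ-single f zero    f≗0 =
  trans (cong (f zero +_) (Σℕ-zero _ (λ i → f≗0 (suc i) λ ()))) (+-identityʳ _)
Σℕ-single f (suc c) f≗0 =
  cong₂ _+_ (f≗0 zero λ ()) (Σℕ-single (λ i → f (suc i)) c (λ i i≢c → f≗0 (suc i) (i≢c ∘ suc-injective)))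

Σℕ-split : ∀ {k} (f : Fin k → ℕ) c → Σℕ f ≡ f c + Σℕ (λ i → [ not (i ≟ᵇ c) ] * f i)
Σℕ-split f c = begin
  Σℕ f                                                             ≡⟨ Σℕ-cong (λ i → []*+[not]*≡ (i ≟ᵇ c) (f i)) ⟨
  Σℕ (λ i → [ i ≟ᵇ c ] * f i + [ not (i ≟ᵇ c) ] * f i)             ≡⟨ Σℕ-+ (λ i → [ i ≟ᵇ c ] * f i) _ ⟩
  Σℕ (λ i → [ i ≟ᵇ c ] * f i) + Σ≢                                 ≡⟨ cong (_+ Σ≢) Σ[≟ᵇ]*f ⟩
  f c + Σ≢                                                         ∎
  where
  open ≡-Reasoning
  Σ≢ : ℕ
  Σ≢ = Σℕ (λ i → [ not (i ≟ᵇ c) ] * f i)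
  Σ[≟ᵇ]*f : Σℕ (λ i → [ i ≟ᵇ c ] * f i) ≡ f c
  Σ[≟ᵇ]*f = trans (Σℕ-single _ c (λ i i≢c → cong (λ b → [ b ] * f i) (≟ᵇ-≢ i≢c)))
                  (trans (cong (λ b → [ b ] * f c) (≟ᵇ-≡ {x = c} refl)) (*-identityˡ (f c)))

Σℕ-others : ∀ {k} (f : Fin k → ℕ) c → Σℕ (λ i → [ not (i ≟ᵇ c) ] * f i) ≡ Σℕ f ∸ f c
Σℕ-others f c = trans (sym (m+n∸m≡n (f c) _)) (cong (_∸ f c) (sym (Σℕ-split f c)))

Σℕ-mono-≤ : ∀ {k} {f g : Fin k → ℕ} → (∀ i → f i ≤ g i) → Σℕ f ≤ Σℕ g
Σℕ-mono-≤ {zero}  f≤g = z≤n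
Σℕ-mono-≤ {suc k} f≤g = +-mono-≤ (f≤g zero) (Σℕ-mono-≤ (λ i → f≤g (suc i)))

Σℕ-mono-< : ∀ {k} {f g : Fin k → ℕ} → (∀ i → f i ≤ g i) → ∀ c → f c < g c → Σℕ f < Σℕ g
Σℕ-mono-< f≤g zero    fc<gc = +-mono-<-≤ fc<gc (Σℕ-mono-≤ (λ i → f≤g (suc i)))
Σℕ-mono-< f≤g (suc c) fc<gc = +-mono-≤-< (f≤g zero) (Σℕ-mono-< (λ i → f≤g (suc i)) c fc<gc)

Σℕ-≤-tight : ∀ {k} {f g : Fin k → ℕ} → (∀ i → f i ≤ g i) → Σℕ g ≤ Σℕ f → ∀ i → f i ≡ g i
Σℕ-≤-tight f≤g Σg≤Σf i = ≤-antisym (f≤g i) (≮⇒≥ λ fi<gi → <⇒≱ (Σℕ-mono-< f≤g i fi<gi) Σg≤Σf)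

Σℕ-[]≡[anyᵇ] : ∀ {k} (f : Fin k → Bool) → (∀ i j → f i ≡ true → f j ≡ true → i ≡ j) →
               Σℕ (λ i → [ f i ]) ≡ [ anyᵇ f ]
Σℕ-[]≡[anyᵇ] {zero}  f unique = refl
Σℕ-[]≡[anyᵇ] {suc k} f unique with f zero in f0≡true
... | true  = cong suc (Σℕ-zero _ (λ i → cong [_] (later-false i)))
  where
  later-false : ∀ i → f (suc i) ≡ false
  later-false i with f (suc i) in fi≡true
  ... | false = refl
  ... | true with () ← unique zero (suc i) f0≡true fi≡true
... | false = Σℕ-[]≡[anyᵇ] (λ i → f (suc i)) (λ i j fi fj → suc-injective (unique _ _ fi fj))

∣p∣≡Σ[∈ᵇ] : ∀ {n} (p : Subset n) → ∣ p ∣ ≡ Σℕ (λ x → [ x ∈ᵇ p ])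
∣p∣≡Σ[∈ᵇ] []          = refl
∣p∣≡Σ[∈ᵇ] (true  ∷ p) = cong suc (∣p∣≡Σ[∈ᵇ] p)
∣p∣≡Σ[∈ᵇ] (false ∷ p) = ∣p∣≡Σ[∈ᵇ] p

nonempty⇒∣p∣≥1 : ∀ {n} {p : Subset n} → Nonempty p → 1 ≤ ∣ p ∣
nonempty⇒∣p∣≥1 {p = p} (x , x∈p) =
  subst (_≤ ∣ p ∣) (∣⁅x⁆∣≡1 x) (p⊆q⇒∣p∣≤∣q∣ (λ y∈⁅x⁆ → subst (_∈ p) (sym (x∈⁅y⁆⇒x≡y x y∈⁅x⁆)) x∈p))

Σℚ-cong : ∀ {k} {f g : Fin k → ℚ} → (∀ i → f i ≡ g i) → Σℚ f ≡ Σℚ g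
Σℚ-cong {zero}  f≗g = refl
Σℚ-cong {suc k} f≗g = cong₂ ℚ._+_ (f≗g zero) (Σℚ-cong (λ i → f≗g (suc i)))

Σℚ-zero : ∀ {k} (f : Fin k → ℚ) → (∀ i → f i ≡ 0ℚ) → Σℚ f ≡ 0ℚ
Σℚ-zero {zero}  f f≗0 = refl
Σℚ-zero {suc k} f f≗0 =
  trans (cong₂ ℚ._+_ (f≗0 zero) (Σℚ-zero (λ i → f (suc i)) (λ i → f≗0 (suc i)))) (ℚ.+-identityˡ 0ℚ)

Σℚ-single : ∀ {k} (f : Fin k → ℚ) c → (∀ i → i ≢ c → f i ≡ 0ℚ) → Σℚ f ≡ f c
Σℚ-single f zero    f≗0 =
  trans (cong (f zero ℚ.+_) (Σℚ-zero _ (λ i → f≗0 (suc i) λ ()))) (ℚ.+-identityʳ _)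
Σℚ-single f (suc c) f≗0 =
  trans (cong₂ ℚ._+_ (f≗0 zero λ ()) (Σℚ-single (λ i → f (suc i)) c (λ i i≢c → f≗0 (suc i) (i≢c ∘ suc-injective))))
        (ℚ.+-identityˡ _)

pointMass : ∀ {k} → Fin k → Fin k → ℚ
pointMass c i = if i ≟ᵇ c then 1ℚ else 0ℚ

pointMass-on : ∀ {k} (c : Fin k) → pointMass c c ≡ 1ℚ
pointMass-on c = cong (λ b → if b then 1ℚ else 0ℚ) (≟ᵇ-≡ {x = c} refl)

pointMass-off : ∀ {k} (c : Fin k) {i} → i ≢ c → pointMass c i ≡ 0ℚ
pointMass-off c i≢c = cong (λ b → if b then 1ℚ else 0ℚ) (≟ᵇ-≢ i≢c)

pointMass≥0 : ∀ {k} (c i : Fin k) → 0ℚ ℚ.≤ pointMass c i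
pointMass≥0 c i with i ≟ᵇ c
... | true  = ℚ.nonNegative⁻¹ 1ℚ
... | false = ℚ.≤-refl

toℚᵘ-frac : ∀ h d → toℚᵘ (frac h (suc d)) ≃ mkℚᵘ (ℤ.+ h) d
toℚᵘ-frac h d = toℚᵘ-fromℚᵘ (mkℚᵘ (ℤ.+ h) d)

frac-zero : ∀ d → frac 0 d ≡ 0ℚ
frac-zero zero    = refl
frac-zero (suc d) = toℚᵘ-injective (≃-trans (toℚᵘ-frac 0 d) (*≡* refl))

frac-+ : ∀ a b d → frac a d ℚ.+ frac b d ≡ frac (a + b) d
frac-+ a b zero    = ℚ.+-identityˡ 0ℚ
frac-+ a b (suc d) = toℚᵘ-injective
  (≃-trans (toℚᵘ-homo-+ (frac a (suc d)) (frac b (suc d)))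
  (≃-trans (+-cong (toℚᵘ-frac a d) (toℚᵘ-frac b d))
  (≃-trans (*≡* cross) (≃-sym (toℚᵘ-frac (a + b) d)))))
  where
  D = ℤ.+ suc d
  cross : (ℤ.+ a ℤ.* D ℤ.+ ℤ.+ b ℤ.* D) ℤ.* D ≡ ℤ.+ (a + b) ℤ.* (D ℤ.* D)
  cross = begin
    (ℤ.+ a ℤ.* D ℤ.+ ℤ.+ b ℤ.* D) ℤ.* D  ≡⟨ cong (ℤ._* D) (ℤ.*-distribʳ-+ D (ℤ.+ a) (ℤ.+ b)) ⟨
    (ℤ.+ a ℤ.+ ℤ.+ b) ℤ.* D ℤ.* D        ≡⟨ ℤ.*-assoc (ℤ.+ a ℤ.+ ℤ.+ b) D D ⟩
    (ℤ.+ a ℤ.+ ℤ.+ b) ℤ.* (D ℤ.* D)      ≡⟨ cong (ℤ._* (D ℤ.* D)) (ℤ.pos-+ a b) ⟨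
    ℤ.+ (a + b) ℤ.* (D ℤ.* D)            ∎
    where open ≡-Reasoning

Σℚ-frac : ∀ {k} (h : Fin k → ℕ) d → Σℚ (λ i → frac (h i) d) ≡ frac (Σℕ h) d
Σℚ-frac {zero}  h d = sym (frac-zero d)
Σℚ-frac {suc k} h d =
  trans (cong (frac (h zero) d ℚ.+_) (Σℚ-frac (λ i → h (suc i)) d)) (frac-+ (h zero) _ d)

frac-≤⇒*≤ : ∀ {a b c d} → 1 ≤ b → 1 ≤ d → frac a b ℚ.≤ frac c d → a * d ≤ c * b
frac-≤⇒*≤ {a} {suc b} {c} {suc d} _ _ a/b≤c/d
  with *≤* a*d≤c*b ← ≤-respʳ-≃ (toℚᵘ-frac c d) (≤-respˡ-≃ (toℚᵘ-frac a b) (toℚᵘ-mono-≤ a/b≤c/d)) =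
  ℤ.drop‿+≤+ (subst₂ ℤ._≤_ (sym (ℤ.pos-* a (suc d))) (sym (ℤ.pos-* c (suc b))) a*d≤c*b)

-- Difference counts in a finite abelian group

module _ {n} (G : FinAbGroup n) where
  open FinAbGroup G renaming (_+_ to _⊕_; _-_ to _⊖_; -_ to ⊖_)

  private
    abelianGroup : AbelianGroup _ _
    abelianGroup = record { isAbelianGroup = isAbelianGroup }

    open AbelianGroupProperties abelianGroup using (⁻¹-anti-homo‿-; xyx⁻¹≈y; ε⁻¹≈ε; ⁻¹-injective)
    open AbelianGroup abelianGroup using (assoc; identityʳ)

  x⊖[x⊖y]≡y : ∀ x y → x ⊖ (x ⊖ y) ≡ y
  x⊖[x⊖y]≡y x y = begin
    x ⊕ (⊖ (x ⊖ y)) ≡⟨ cong (x ⊕_) (⁻¹-anti-homo‿- x y) ⟩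
    x ⊕ (y ⊖ x)     ≡⟨ assoc x y (⊖ x) ⟨
    (x ⊕ y) ⊖ x     ≡⟨ xyx⁻¹≈y x y ⟩
    y               ∎
    where open ≡-Reasoning

  x⊖0≡x : ∀ x → x ⊖ 0# ≡ x
  x⊖0≡x x = trans (cong (x ⊕_) ε⁻¹≈ε) (identityʳ x)

  ⊖x≢0 : ∀ {x} → x ≢ 0# → ⊖ x ≢ 0#
  ⊖x≢0 x≢0 ⊖x≡0 = x≢0 (⁻¹-injective (trans ⊖x≡0 (sym ε⁻¹≈ε)))

  diffCount : Subset n → Subset n → Fin n → ℕ
  diffCount B C d = Σℕ (λ x → Σℕ (λ y → [ (x ∈ᵇ B) ∧ (y ∈ᵇ C) ∧ ((x ⊖ y) ≟ᵇ d) ]))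

  diffCount-shift : ∀ B C d → diffCount B C d ≡ Σℕ (λ x → [ x ∈ᵇ B ] * [ (x ⊖ d) ∈ᵇ C ])
  diffCount-shift B C d = Σℕ-cong λ x →
    trans (Σℕ-single _ (x ⊖ d) (λ y y≢x⊖d → [∧∧≟ᵇ]≡0 (x ∈ᵇ B) (y ∈ᵇ C) (y≢x⊖d ∘ x⊖y≡d⇒y≡x⊖d x y)))
          ([∧∧≟ᵇ]≡[]*[] (x ∈ᵇ B) ((x ⊖ d) ∈ᵇ C) (x⊖[x⊖y]≡y x d))
    where
    x⊖y≡d⇒y≡x⊖d : ∀ x y → x ⊖ y ≡ d → y ≡ x ⊖ d
    x⊖y≡d⇒y≡x⊖d x y x⊖y≡d = trans (sym (x⊖[x⊖y]≡y x y)) (cong (λ z → x ⊖ z) x⊖y≡d)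

  Σ-diffCount : ∀ B C → Σℕ (diffCount B C) ≡ ∣ B ∣ * ∣ C ∣
  Σ-diffCount B C = begin
    Σℕ (λ d → Σℕ (λ x → Σℕ (λ y → t x y d)))        ≡⟨ Σℕ-swap (λ d x → Σℕ (λ y → t x y d)) ⟩
    Σℕ (λ x → Σℕ (λ d → Σℕ (λ y → t x y d)))        ≡⟨ Σℕ-cong (λ x → Σℕ-swap (λ d y → t x y d)) ⟩
    Σℕ (λ x → Σℕ (λ y → Σℕ (λ d → t x y d)))        ≡⟨ Σℕ-cong (λ x → Σℕ-cong (λ y → Σ-t x y)) ⟩
    Σℕ (λ x → Σℕ (λ y → [ x ∈ᵇ B ] * [ y ∈ᵇ C ]))  ≡⟨ Σℕ-cong (λ x → Σℕ-*ˡ [ x ∈ᵇ B ] (λ y → [ y ∈ᵇ C ])) ⟩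
    Σℕ (λ x → [ x ∈ᵇ B ] * Σℕ (λ y → [ y ∈ᵇ C ]))  ≡⟨ Σℕ-*ʳ _ (λ x → [ x ∈ᵇ B ]) ⟩
    Σℕ (λ x → [ x ∈ᵇ B ]) * Σℕ (λ y → [ y ∈ᵇ C ])  ≡⟨ cong₂ _*_ (∣p∣≡Σ[∈ᵇ] B) (∣p∣≡Σ[∈ᵇ] C) ⟨
    ∣ B ∣ * ∣ C ∣                                  ∎
    where
    open ≡-Reasoning
    t : Fin n → Fin n → Fin n → ℕ
    t x y d = [ (x ∈ᵇ B) ∧ (y ∈ᵇ C) ∧ ((x ⊖ y) ≟ᵇ d) ]
    Σ-t : ∀ x y → Σℕ (t x y) ≡ [ x ∈ᵇ B ] * [ y ∈ᵇ C ]
    Σ-t x y = trans (Σℕ-single (t x y) (x ⊖ y) (λ d d≢x⊖y → [∧∧≟ᵇ]≡0 (x ∈ᵇ B) (y ∈ᵇ C) (d≢x⊖y ∘ sym)))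
                    ([∧∧≟ᵇ]≡[]*[] (x ∈ᵇ B) (y ∈ᵇ C) refl)

  diffCount-zero : ∀ B C → (∀ x → x ∈ B → x ∉ C) → diffCount B C 0# ≡ 0
  diffCount-zero B C B∩C≡∅ = trans (diffCount-shift B C 0#) (Σℕ-zero _ λ x →
    subst (λ z → [ x ∈ᵇ B ] * [ z ∈ᵇ C ] ≡ 0) (sym (x⊖0≡x x))
          ([]*[]≡0 λ x∈B x∈C → B∩C≡∅ x (lookup⇒[]= x B x∈B) (lookup⇒[]= x C x∈C)))

  module _ {m} {A : Fin m → Subset n} where

    Σ-extDiffCount : ∀ i → Σℕ (extDiffCount G A i) ≡ ∣ A i ∣ * (total A ∸ ∣ A i ∣)
    Σ-extDiffCount i = begin
      Σℕ (λ d → Σℕ (λ j → [ j≢i j ] * diffCount (A i) (A j) d))  ≡⟨ Σℕ-swap (λ d j → [ j≢i j ] * diffCount (A i) (A j) d) ⟩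
      Σℕ (λ j → Σℕ (λ d → [ j≢i j ] * diffCount (A i) (A j) d))  ≡⟨ Σℕ-cong (λ j → Σℕ-*ˡ [ j≢i j ] (diffCount (A i) (A j))) ⟩
      Σℕ (λ j → [ j≢i j ] * Σℕ (diffCount (A i) (A j)))          ≡⟨ Σℕ-cong (λ j → cong ([ j≢i j ] *_) (Σ-diffCount (A i) (A j))) ⟩
      Σℕ (λ j → [ j≢i j ] * (∣ A i ∣ * ∣ A j ∣))                  ≡⟨ Σℕ-cong (λ j → *-leftComm [ j≢i j ] ∣ A i ∣ ∣ A j ∣) ⟩
      Σℕ (λ j → ∣ A i ∣ * ([ j≢i j ] * ∣ A j ∣))                  ≡⟨ Σℕ-*ˡ ∣ A i ∣ (λ j → [ j≢i j ] * ∣ A j ∣) ⟩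
      ∣ A i ∣ * Σℕ (λ j → [ j≢i j ] * ∣ A j ∣)                    ≡⟨ cong (∣ A i ∣ *_) (Σℕ-others (λ j → ∣ A j ∣) i) ⟩
      ∣ A i ∣ * (total A ∸ ∣ A i ∣)                               ∎
      where
      open ≡-Reasoning
      j≢i : Fin m → Bool
      j≢i j = not (j ≟ᵇ i)

    module _ (disjoint : PairwiseDisjoint A) where

      [inOthers]≡Σ : ∀ i z → [ inOthers A i z ] ≡ Σℕ (λ j → [ not (j ≟ᵇ i) ] * [ z ∈ᵇ A j ])
      [inOthers]≡Σ i z =
        trans (sym (Σℕ-[]≡[anyᵇ] (λ j → not (j ≟ᵇ i) ∧ (z ∈ᵇ A j)) unique))
              (Σℕ-cong (λ j → [∧]≡[]*[] (not (j ≟ᵇ i)) (z ∈ᵇ A j)))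
        where
        unique : ∀ j j′ → not (j ≟ᵇ i) ∧ (z ∈ᵇ A j) ≡ true → not (j′ ≟ᵇ i) ∧ (z ∈ᵇ A j′) ≡ true → j ≡ j′
        unique j j′ z∈Aj z∈Aj′ with j ≟ j′
        ... | yes j≡j′ = j≡j′
        ... | no  j≢j′ = ⊥-elim (disjoint j j′ j≢j′ z (lookup⇒[]= z (A j) (∧-conicalʳ _ _ z∈Aj))
                                                       (lookup⇒[]= z (A j′) (∧-conicalʳ _ _ z∈Aj′)))

      extDiffCount-shift : ∀ i d → extDiffCount G A i d ≡ Σℕ (λ x → [ x ∈ᵇ A i ] * [ inOthers A i (x ⊖ d) ])
      extDiffCount-shift i d = begin
        Σℕ (λ j → [ j≢i j ] * diffCount (A i) (A j) d)                   ≡⟨ Σℕ-cong (λ j → cong ([ j≢i j ] *_) (diffCount-shift (A i) (A j) d)) ⟩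
        Σℕ (λ j → [ j≢i j ] * Σℕ (λ x → [ x ∈ᵇ A i ] * [ z x ∈ᵇ A j ]))  ≡⟨ Σℕ-cong (λ j → Σℕ-*ˡ [ j≢i j ] (λ x → [ x ∈ᵇ A i ] * [ z x ∈ᵇ A j ])) ⟨
        Σℕ (λ j → Σℕ (λ x → [ j≢i j ] * ([ x ∈ᵇ A i ] * [ z x ∈ᵇ A j ])))  ≡⟨ Σℕ-swap (λ j x → [ j≢i j ] * ([ x ∈ᵇ A i ] * [ z x ∈ᵇ A j ])) ⟩
        Σℕ (λ x → Σℕ (λ j → [ j≢i j ] * ([ x ∈ᵇ A i ] * [ z x ∈ᵇ A j ])))  ≡⟨ Σℕ-cong (λ x → Σℕ-cong (λ j → *-leftComm [ j≢i j ] [ x ∈ᵇ A i ] _)) ⟩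
        Σℕ (λ x → Σℕ (λ j → [ x ∈ᵇ A i ] * ([ j≢i j ] * [ z x ∈ᵇ A j ])))  ≡⟨ Σℕ-cong (λ x → Σℕ-*ˡ [ x ∈ᵇ A i ] (λ j → [ j≢i j ] * [ z x ∈ᵇ A j ])) ⟩
        Σℕ (λ x → [ x ∈ᵇ A i ] * Σℕ (λ j → [ j≢i j ] * [ z x ∈ᵇ A j ]))  ≡⟨ Σℕ-cong (λ x → cong ([ x ∈ᵇ A i ] *_) ([inOthers]≡Σ i (z x))) ⟨
        Σℕ (λ x → [ x ∈ᵇ A i ] * [ inOthers A i (z x) ])                 ∎
        where
        open ≡-Reasoning
        j≢i : Fin m → Bool
        j≢i j = not (j ≟ᵇ i)
        z : Fin n → Fin n
        z x = x ⊖ d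

      extDiffCount-zero : ∀ i → extDiffCount G A i 0# ≡ 0
      extDiffCount-zero i = Σℕ-zero _ term
        where
        term : ∀ j → [ not (j ≟ᵇ i) ] * diffCount (A i) (A j) 0# ≡ 0
        term j with j ≟ i
        ... | yes _   = refl
        ... | no  j≢i = trans (*-identityˡ _) (diffCount-zero (A i) (A j) (disjoint i j (j≢i ∘ sym)))

-- Point-mass strategies against an AMD code

module _ {n} {G : FinAbGroup n} {m} (C : AMDCode G m) where
  open FinAbGroup G renaming (_+_ to _⊕_; _-_ to _⊖_; -_ to ⊖_)
  open AMDCode C

  pointStrategy : ∀ Δ → Δ ≢ 0# → Strategy C
  pointStrategy Δ Δ≢0 = record
    { p     = pointMass Δ
    ; p0    = pointMass-off Δ (Δ≢0 ∘ sym)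
    ; p≥0   = pointMass≥0 Δ
    ; p-sum = trans (Σℚ-single (pointMass Δ) Δ (λ x → pointMass-off Δ)) (pointMass-on Δ)
    }

  winProb-pointStrategy : ∀ s Δ (Δ≢0 : Δ ≢ 0#) →
    winProb C s (pointStrategy Δ Δ≢0) ≡ Σℚ (λ g → enc s g ℚ.* frac [ inOthers A s (g ⊕ Δ) ] 1)
  winProb-pointStrategy s Δ _ =
    trans (Σℚ-single _ Δ (λ x x≢Δ → trans (cong (ℚ._* win x) (pointMass-off Δ x≢Δ)) (ℚ.*-zeroˡ (win x))))
          (trans (cong (ℚ._* win Δ) (pointMass-on Δ)) (ℚ.*-identityˡ (win Δ)))
    where
    win : Fin n → ℚ
    win Δ′ = Σℚ (λ g → enc s g ℚ.* frac [ inOthers A s (g ⊕ Δ′) ] 1)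

  Σ-equiprobable : Equiprobable C → ∀ s (b : Fin n → Bool) →
    Σℚ (λ g → enc s g ℚ.* frac [ b g ] 1) ≡ frac (Σℕ (λ g → [ g ∈ᵇ A s ] * [ b g ])) ∣ A s ∣
  Σ-equiprobable equiprobable s b =
    trans (Σℚ-cong (λ g → trans (cong (ℚ._* frac [ b g ] 1) (equiprobable s g)) (term (g ∈ᵇ A s) (b g))))
          (Σℚ-frac (λ g → [ g ∈ᵇ A s ] * [ b g ]) ∣ A s ∣)
    where
    term : ∀ c b → (if c then frac 1 ∣ A s ∣ else 0ℚ) ℚ.* frac [ b ] 1 ≡ frac ([ c ] * [ b ]) ∣ A s ∣
    term true  true  = ℚ.*-identityʳ _
    term true  false = trans (ℚ.*-zeroʳ (frac 1 ∣ A s ∣)) (sym (frac-zero ∣ A s ∣))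
    term false b     = trans (ℚ.*-zeroˡ (frac [ b ] 1)) (sym (frac-zero ∣ A s ∣))

  module _ (equiprobable : Equiprobable C) (rOptimal : ROptimal C) (2≤n : 2 ≤ n) where

    extDiffCount-bound : ∀ s d → d ≢ 0# →
      extDiffCount G A s d * (n ∸ 1) ≤ ∣ A s ∣ * (total A ∸ ∣ A s ∣)
    extDiffCount-bound s d d≢0 =
      subst (extDiffCount G A s d * (n ∸ 1) ≤_) (*-comm (total A ∸ ∣ A s ∣) ∣ A s ∣)
            (frac-≤⇒*≤ (nonempty⇒∣p∣≥1 (nonempty s)) (∸-monoˡ-≤ 1 2≤n) (subst (ℚ._≤ _) win≡ (proj₂ (rOptimal s) σ)))
      where
      σ : Strategy C
      σ = pointStrategy (⊖ d) (⊖x≢0 G d≢0)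
      win≡ : winProb C s σ ≡ frac (extDiffCount G A s d) ∣ A s ∣
      win≡ = begin
        winProb C s σ                                                           ≡⟨ winProb-pointStrategy s (⊖ d) (⊖x≢0 G d≢0) ⟩
        Σℚ (λ g → enc s g ℚ.* frac [ inOthers A s (g ⊖ d) ] 1)                  ≡⟨ Σ-equiprobable equiprobable s (λ g → inOthers A s (g ⊖ d)) ⟩
        frac (Σℕ (λ g → [ g ∈ᵇ A s ] * [ inOthers A s (g ⊖ d) ])) ∣ A s ∣       ≡⟨ cong (λ t → frac t ∣ A s ∣) (extDiffCount-shift G {A = A} disjoint s d) ⟨
        frac (extDiffCount G A s d) ∣ A s ∣                                     ∎
        where open ≡-Reasoning

    extDiffCount-regular : ∀ s d → d ≢ 0# →
      extDiffCount G A s d * (n ∸ 1) ≡ ∣ A s ∣ * (total A ∸ ∣ A s ∣)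
    extDiffCount-regular s d d≢0 =
      trans (Σℕ-≤-tight f≤g (≤-reflexive Σg≡Σf) d)
            (trans (cong (λ b → [ not b ] * M) (≟ᵇ-≢ d≢0)) (*-identityˡ M))
      where
      M : ℕ
      M = ∣ A s ∣ * (total A ∸ ∣ A s ∣)
      f g : Fin n → ℕ
      f d′ = extDiffCount G A s d′ * (n ∸ 1)
      g d′ = [ not (d′ ≟ᵇ 0#) ] * M
      f≤g : ∀ d′ → f d′ ≤ g d′
      f≤g d′ with d′ ≟ 0#
      ... | yes refl = ≤-reflexive (cong (_* (n ∸ 1)) (extDiffCount-zero G {A = A} disjoint s))
      ... | no  d′≢0 = subst (f d′ ≤_) (sym (*-identityˡ M)) (extDiffCount-bound s d′ d′≢0)
      Σg≡Σf : Σℕ g ≡ Σℕ f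
      Σg≡Σf = begin
        Σℕ g                               ≡⟨ Σℕ-others (λ _ → M) 0# ⟩
        Σℕ {n} (λ _ → M) ∸ M               ≡⟨ cong (_∸ M) (Σℕ-const {n} M) ⟩
        n * M ∸ M                          ≡⟨ cong (n * M ∸_) (*-identityˡ M) ⟨
        n * M ∸ 1 * M                      ≡⟨ *-distribʳ-∸ M n 1 ⟨
        (n ∸ 1) * M                        ≡⟨ *-comm (n ∸ 1) M ⟩
        M * (n ∸ 1)                        ≡⟨ cong (_* (n ∸ 1)) (Σ-extDiffCount G {A = A} s) ⟨
        Σℕ (extDiffCount G A s) * (n ∸ 1)  ≡⟨ Σℕ-*ʳ (n ∸ 1) (extDiffCount G A s) ⟨
        Σℕ f                               ∎
        where open ≡-Reasoning

mainTheorem17 : (n : ℕ) → 2 ≤ n → (G : FinAbGroup n) → (m : ℕ) → (C : AMDCode G m) →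
    Equiprobable C → ROptimal C →
    ∃ λ (λs : Fin m → ℕ) →
      (∀ i → λs i * (n ∸ 1) ≡ ∣ AMDCode.A C i ∣ * (total (AMDCode.A C) ∸ ∣ AMDCode.A C i ∣))
      × IsGSEDF G m (λ i → ∣ AMDCode.A C i ∣) λs (AMDCode.A C)
-- Matching on 2 ≤ n exposes n = 2 + _, which provides the nonzero element d₀
-- and the NonZero (n ∸ 1) instance used for cancellation.
mainTheorem17 n 2≤n@(s≤s (s≤s _)) G m C equiprobable rOptimal =
  λs , (λ i → regular i d₀ d₀≢0) , disjoint , (λ _ → refl) , spectrum
  where
  open FinAbGroup G using (0#)
  open AMDCode C using (A; disjoint)

  regular : ∀ i d → d ≢ 0# → extDiffCount G A i d * (n ∸ 1) ≡ ∣ A i ∣ * (total A ∸ ∣ A i ∣)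
  regular = extDiffCount-regular C equiprobable rOptimal 2≤n

  d₀ : Fin n
  d₀ = punchIn 0# zero
  d₀≢0 : d₀ ≢ 0#
  d₀≢0 = punchInᵢ≢i 0# zero

  λs : Fin m → ℕ
  λs i = extDiffCount G A i d₀

  spectrum : ∀ i d → extDiffCount G A i d ≡ (if d ≟ᵇ 0# then 0 else λs i)
  spectrum i d = byCases (d ≟ 0#)
    where
    byCases : (d≟0 : Dec (d ≡ 0#)) → extDiffCount G A i d ≡ (if isYes d≟0 then 0 else λs i)
    byCases (yes d≡0) = trans (cong (extDiffCount G A i) d≡0) (extDiffCount-zero G {A = A} disjoint i)
    byCases (no  d≢0) =
      *-cancelʳ-≡ (extDiffCount G A i d) (λs i) (n ∸ 1) (trans (regular i d d≢0) (sym (regular i d₀ d₀≢0)))
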